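{- Let $(\mathbf{C},\mathcal{M})$ be a finitary $\mathcal{M}$-adhesive category ($\mathcal{M}$ a class of monomorphisms) with $\mathcal{M}$-effective unions, an $\mathcal{M}$-initial object $\varnothing$, an epi-$\mathcal{M}$-factorisation, existence of final pullback complements (FPCs) for all pairs of composable $\mathcal{M}$-morphisms, and stability of $\mathcal{M}$-morphisms under FPCs. Let $\mathcal{N}$ be a set of objects, with global constraint $\mathsf{c}_{\mathcal{N}}$ and forbidden relations $\mathcal{S}_{\mathcal{N}}$ as in the context. Let $r=(O\hookleftarrow K\hookrightarrow I)$ be a linear rule (both arrows in $\mathcal{M}$) with $O,K,I\vDash\mathsf{c}_{\mathcal{N}}$. Define a condition $\mathsf{c}_I$ over $I$ as follows: for each $(C_2\hookleftarrow D\hookrightarrow C_1)\in\mathcal{S}_{\mathcal{N}}$ and each pullback embedding of $(C_2\hookleftarrow D)$ into $(O\hookleftarrow K)$, i.e. each pair of $\mathcal{M}$-morphisms $C_2\hookrightarrow O$, $D\hookrightarrow K$ such that $(C_2\hookleftarrow D\hookrightarrow K)$ is the pullback of $(C_2\hookrightarrow O\hookleftarrow K)$, form the pushout $(C_1\hookrightarrow P\hookleftarrow I)$ of the span $(C_1\hookleftarrow D\hookrightarrow K\hookrightarrow I)$; if $P\vDash\mathsf{c}_{\mathcal{N}}$, this pullback embedding contributes the condition $\neg\exists(I\hookrightarrow P)$. Let $\mathsf{c}_I$ be the conjunction of all these contributions. Then $\mathsf{c}_I$ is the (minimal) constraint-preserving application condition for $r$: for every object $X_0$ with $X_0\vDash\mathsf{c}_{\mathcal{N}}$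 and every $\mathcal{M}$-morphism $m:I\hookrightarrow X_0$, the object $X_1$ obtained by the SqPO direct derivation of $X_0$ along $r$ at $m$ satisfies $X_1\vDash\mathsf{c}_{\mathcal{N}}$ if and only if $m\vDash\mathsf{c}_I$.
   Context: $X\vDash\mathsf{c}_{\mathcal{N}}$ means: for no $N\in\mathcal{N}$ is there an $\mathcal{M}$-morphism $N\hookrightarrow X$. $\mathcal{S}_{\mathcal{N}}$ is the set of spans $(C_1\hookleftarrow D\hookrightarrow C_2)$ of $\mathcal{M}$-morphisms with $C_1,D,C_2\vDash\mathsf{c}_{\mathcal{N}}$ whose pushout is isomorphic to some $N\in\mathcal{N}$. An $\mathcal{M}$-morphism $m:I\hookrightarrow X_0$ satisfies $\neg\exists(f:I\hookrightarrow P)$ iff there is no $\mathcal{M}$-morphism $g:P\hookrightarrow X_0$ with $g\circ f=m$; a conjunction is satisfied iff each conjunct is. SqPO direct derivation of $X_0$ along $r=(O\hookleftarrow K\hookrightarrow I)$ at $m$: form the final pullback complement $K\hookrightarrow\overline{X}_0\hookrightarrow X_0$ of $K\hookrightarrow I\xrightarrow{m} X_0$, then $X_1$ is the pushout of $O\hookleftarrow K\hookrightarrow\overline{X}_0$. -}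

module Defs where

open import Level using (Level; _⊔_) renaming (suc to lsuc)
open import Data.Nat using (ℕ)
open import Data.Fin using (Fin)
open import Data.Product using (Σ; _×_; _,_; proj₁; proj₂)
open import Relation.Binary using (Rel; IsEquivalence)
open import Relation.Nullary using (¬_)
open import Function.Bundles using (_⇔_)

record Category (o ℓ e : Level) : Set (lsuc (o ⊔ ℓ ⊔ e)) where
  infix  4 _≈_
  infixr 9 _∘_
  field
    Obj : Set o
    _⇒_ : Obj → Obj → Set ℓ
    _≈_ : ∀ {A B} → Rel (A ⇒ B) e
    id  : ∀ {A} → A ⇒ A
    _∘_ : ∀ {A B C} → B ⇒ C → A ⇒ B → A ⇒ C
    equiv     : ∀ {A B} → IsEquivalence (_≈_ {A} {B})
    ∘-resp-≈  : ∀ {A B C} {f h : B ⇒ C} {g i : A ⇒ B} → f ≈ h → g ≈ i → f ∘ g ≈ h ∘ i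
    assoc     : ∀ {A B C D} {f : A ⇒ B} {g : B ⇒ C} {h : C ⇒ D} → (h ∘ g) ∘ f ≈ h ∘ (g ∘ f)
    identityˡ : ∀ {A B} {f : A ⇒ B} → id ∘ f ≈ f
    identityʳ : ∀ {A B} {f : A ⇒ B} → f ∘ id ≈ f

module Notions {o ℓ e} (𝐂 : Category o ℓ e) where
  open Category 𝐂 public

  Mono : ∀ {A B} → A ⇒ B → Set (o ⊔ ℓ ⊔ e)
  Mono {A} f = ∀ {X} (g h : X ⇒ A) → f ∘ g ≈ f ∘ h → g ≈ h

  Epi : ∀ {A B} → A ⇒ B → Set (o ⊔ ℓ ⊔ e)
  Epi {B = B} f = ∀ {X} (g h : B ⇒ X) → g ∘ f ≈ h ∘ f → g ≈ h

  IsIso : ∀ {A B} → A ⇒ B → Set (ℓ ⊔ e)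
  IsIso {A} {B} f = Σ (B ⇒ A) λ g → (g ∘ f ≈ id) × (f ∘ g ≈ id)

  _≅_ : Obj → Obj → Set (ℓ ⊔ e)
  A ≅ B = Σ (A ⇒ B) IsIso

  IsPullback : ∀ {P A B Z} (p₁ : P ⇒ A) (p₂ : P ⇒ B) (f : A ⇒ Z) (g : B ⇒ Z) → Set (o ⊔ ℓ ⊔ e)
  IsPullback {P} {A} {B} p₁ p₂ f g =
    (f ∘ p₁ ≈ g ∘ p₂) ×
    (∀ {X} (q₁ : X ⇒ A) (q₂ : X ⇒ B) → f ∘ q₁ ≈ g ∘ q₂ →
      Σ (X ⇒ P) λ u → (p₁ ∘ u ≈ q₁) × (p₂ ∘ u ≈ q₂) ×
        (∀ (v : X ⇒ P) → p₁ ∘ v ≈ q₁ → p₂ ∘ v ≈ q₂ → v ≈ u))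

  IsPushout : ∀ {Z A B P} (f : Z ⇒ A) (g : Z ⇒ B) (i₁ : A ⇒ P) (i₂ : B ⇒ P) → Set (o ⊔ ℓ ⊔ e)
  IsPushout {Z} {A} {B} {P} f g i₁ i₂ =
    (i₁ ∘ f ≈ i₂ ∘ g) ×
    (∀ {X} (j₁ : A ⇒ X) (j₂ : B ⇒ X) → j₁ ∘ f ≈ j₂ ∘ g →
      Σ (P ⇒ X) λ u → (u ∘ i₁ ≈ j₁) × (u ∘ i₂ ≈ j₂) ×
        (∀ (v : P ⇒ X) → v ∘ i₁ ≈ j₁ → v ∘ i₂ ≈ j₂ → v ≈ u))

  IsInitial : Obj → Set (o ⊔ ℓ ⊔ e)
  IsInitial Ø = ∀ X → Σ (Ø ⇒ X) λ u → ∀ (v : Ø ⇒ X) → v ≈ u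

  IsFPC : ∀ {A B C D} (a : A ⇒ B) (b : B ⇒ C) (d : A ⇒ D) (c : D ⇒ C) → Set (o ⊔ ℓ ⊔ e)
  IsFPC {A} {B} {C} {D} a b d c =
    IsPullback a d b c ×
    (∀ {A' D'} (a' : A' ⇒ B) (d' : A' ⇒ D') (c' : D' ⇒ C) (x : A' ⇒ A) →
       IsPullback a' d' b c' → a ∘ x ≈ a' →
       Σ (D' ⇒ D) λ h → (c ∘ h ≈ c') × (h ∘ d' ≈ d ∘ x) ×
         (∀ (h' : D' ⇒ D) → c ∘ h' ≈ c' → h' ∘ d' ≈ d ∘ x → h' ≈ h))

module _ {o ℓ e m} (𝐂 : Category o ℓ e) (M : ∀ {A B} → Category._⇒_ 𝐂 A B → Set m) where
  open Notions 𝐂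

  -- M-adhesive category (Ehrig et al.; pushouts along M are vertical weak VK squares)
  record IsMAdhesive : Set (lsuc (o ⊔ ℓ ⊔ e ⊔ m)) where
    field
      M-resp-≈   : ∀ {A B} {f g : A ⇒ B} → f ≈ g → M f → M g
      M-mono     : ∀ {A B} {f : A ⇒ B} → M f → Mono f
      M-iso      : ∀ {A B} {f : A ⇒ B} → IsIso f → M f
      M-comp     : ∀ {A B C} {f : A ⇒ B} {g : B ⇒ C} → M f → M g → M (g ∘ f)
      M-decomp   : ∀ {A B C} {f : A ⇒ B} {g : B ⇒ C} → M (g ∘ f) → M g → M f
      pushout-M  : ∀ {Z A B} (f : Z ⇒ A) (g : Z ⇒ B) → M f →
                   Σ Obj λ P → Σ (A ⇒ P) λ i₁ → Σ (B ⇒ P) λ i₂ → IsPushout f g i₁ i₂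
      pullback-M : ∀ {A B Z} (f : A ⇒ Z) (g : B ⇒ Z) → M g →
                   Σ Obj λ P → Σ (P ⇒ A) λ p₁ → Σ (P ⇒ B) λ p₂ → IsPullback p₁ p₂ f g
      M-pushout-stable  : ∀ {Z A B P} {f : Z ⇒ A} {g : Z ⇒ B} {i₁ : A ⇒ P} {i₂ : B ⇒ P} →
                          IsPushout f g i₁ i₂ → M f → M i₂
      M-pullback-stable : ∀ {P A B Z} {p₁ : P ⇒ A} {p₂ : P ⇒ B} {f : A ⇒ Z} {g : B ⇒ Z} →
                          IsPullback p₁ p₂ f g → M g → M p₁
      -- vertical weak van Kampen property of pushouts along M.
      -- Bottom face: pushout  n ∘ f ≈ g ∘ m  (m ∈ M); top face  n' ∘ f' ≈ g' ∘ m';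
      -- vertical morphisms a , b , c , d.
      vk : ∀ {A B C D A' B' C' D'}
             {f : A ⇒ B} {m : A ⇒ C} {n : B ⇒ D} {g : C ⇒ D}
             {f' : A' ⇒ B'} {m' : A' ⇒ C'} {n' : B' ⇒ D'} {g' : C' ⇒ D'}
             {a : A' ⇒ A} {b : B' ⇒ B} {c : C' ⇒ C} {d : D' ⇒ D} →
           M m → IsPushout f m n g →
           n' ∘ f' ≈ g' ∘ m' →
           IsPullback a f' f b → IsPullback a m' m c →
           n ∘ b ≈ d ∘ n' → g ∘ c ≈ d ∘ g' →
           M b → M c → M d →
           (IsPushout f' m' n' g' ⇔ (IsPullback b n' n d × IsPullback c g' g d))

  SubObj : Obj → Set (o ⊔ ℓ ⊔ m)
  SubObj X = Σ Obj λ A → Σ (A ⇒ X) M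

  Finitary : Set (o ⊔ ℓ ⊔ e ⊔ m)
  Finitary = ∀ X → Σ ℕ λ k → Σ (Fin k → SubObj X) λ s →
    ∀ {A} (f : A ⇒ X) → M f → Σ (Fin k) λ i →
      Σ (A ⇒ proj₁ (s i)) λ φ → IsIso φ × (proj₁ (proj₂ (s i)) ∘ φ ≈ f)

  MEffectiveUnions : Set (o ⊔ ℓ ⊔ e ⊔ m)
  MEffectiveUnions = ∀ {A B C D E} {b₁ : A ⇒ B} {c₁ : A ⇒ C} {b : B ⇒ D} {c : C ⇒ D}
    {e₁ : B ⇒ E} {e₂ : C ⇒ E} (u : E ⇒ D) →
    M b → M c → IsPullback b₁ c₁ b c → IsPushout b₁ c₁ e₁ e₂ →
    u ∘ e₁ ≈ b → u ∘ e₂ ≈ c → M u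

  HasMInitial : Set (o ⊔ ℓ ⊔ e ⊔ m)
  HasMInitial = Σ Obj λ Ø → IsInitial Ø × (∀ X (f : Ø ⇒ X) → M f)

  HasEpiMFactorisation : Set (o ⊔ ℓ ⊔ e ⊔ m)
  HasEpiMFactorisation =
    (∀ {A B} (f : A ⇒ B) → Σ Obj λ E → Σ (A ⇒ E) λ ε → Σ (E ⇒ B) λ μ →
       Epi ε × M μ × (μ ∘ ε ≈ f)) ×
    (∀ {A B E E'} {ε : A ⇒ E} {μ : E ⇒ B} {ε' : A ⇒ E'} {μ' : E' ⇒ B} →
       Epi ε → M μ → Epi ε' → M μ' → μ ∘ ε ≈ μ' ∘ ε' →
       Σ (E ⇒ E') λ φ → IsIso φ × (φ ∘ ε ≈ ε') × (μ' ∘ φ ≈ μ))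

  HasFPCsForM : Set (o ⊔ ℓ ⊔ e ⊔ m)
  HasFPCsForM = ∀ {A B C} (a : A ⇒ B) (b : B ⇒ C) → M a → M b →
    Σ Obj λ D → Σ (A ⇒ D) λ d → Σ (D ⇒ C) λ c → IsFPC a b d c

  MStableUnderFPC : Set (o ⊔ ℓ ⊔ e ⊔ m)
  MStableUnderFPC = ∀ {A B C D} {a : A ⇒ B} {b : B ⇒ C} {d : A ⇒ D} {c : D ⇒ C} →
    M a → M b → IsFPC a b d c → M d × M c

module Constraints {o ℓ e m n} (𝐂 : Category o ℓ e)
  (M : ∀ {A B} → Category._⇒_ 𝐂 A B → Set m)
  (𝒩 : Category.Obj 𝐂 → Set n) where
  open Notions 𝐂 public

  _⊨c𝒩 : Obj → Set (o ⊔ ℓ ⊔ m ⊔ n)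
  X ⊨c𝒩 = ∀ N → 𝒩 N → ¬ (Σ (N ⇒ X) M)

  InS𝒩 : ∀ {C₁ D C₂} → D ⇒ C₁ → D ⇒ C₂ → Set (o ⊔ ℓ ⊔ e ⊔ m ⊔ n)
  InS𝒩 {C₁} {D} {C₂} d₁ d₂ = M d₁ × M d₂ × C₁ ⊨c𝒩 × D ⊨c𝒩 × C₂ ⊨c𝒩 ×
    (Σ Obj λ P → Σ (C₁ ⇒ P) λ i₁ → Σ (C₂ ⇒ P) λ i₂ →
       IsPushout d₁ d₂ i₁ i₂ × (Σ Obj λ N → 𝒩 N × (P ≅ N)))

  ⊨¬∃ : ∀ {I P X} (f : I ⇒ P) (μ : I ⇒ X) → Set (ℓ ⊔ e ⊔ m)
  ⊨¬∃ {I} {P} {X} f μ = ¬ (Σ (P ⇒ X) λ g → M g × (g ∘ f ≈ μ))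

  _⊨cI[_,_] : ∀ {O K I X₀} (μ : I ⇒ X₀) (rO : K ⇒ O) (rI : K ⇒ I) → Set (o ⊔ ℓ ⊔ e ⊔ m ⊔ n)
  _⊨cI[_,_] {O} {K} {I} {X₀} μ rO rI =
    ∀ {C₁ D C₂} (δ₂ : D ⇒ C₂) (δ₁ : D ⇒ C₁) → InS𝒩 δ₂ δ₁ →
    ∀ (x : C₂ ⇒ O) (y : D ⇒ K) → M x → M y → IsPullback δ₂ y x rO →
    ∀ {P} (p₁ : C₁ ⇒ P) (p₂ : I ⇒ P) → IsPushout δ₁ (rI ∘ y) p₁ p₂ →
    P ⊨c𝒩 → ⊨¬∃ p₂ μ

module Submission where

-- Fix the SqPO step X₀ ↩ X̄₀ ↪ X₁ along r = (O ↩ K ↪ I) at m.  Both directions of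
-- the equivalence  X₁ ⊨ c_𝒩  ⇔  m ⊨ c_I  pass through one intermediate notion, an
-- *anchored overlap*: a forbidden relation (C₂ ↩ D ↪ C₁) ∈ S_𝒩 together with a
-- pullback embedding (C₂ ↪ O , D ↪ K) into the rule and an M-morphism C₁ ↪ X̄₀
-- for which D is the pullback of K ↪ X̄₀ ↩ C₁.  We show
--   * a violation N ↪ X₁ yields an anchored overlap (pull N back along the
--     pushout square defining X₁; van Kampen makes D a pushout decomposition of N),
--   * an anchored overlap yields a violation N ↪ X₁ (M-effective unions),
--   * an anchored overlap yields a match P ↪ X₀ of the pushout P of C₁ ↩ D ↪ I
--     (pasting with the FPC square and M-effective unions),
--   * such a match P ↪ X₀ yields an anchored overlap (universality of the FPC).

open import Level using (_⊔_)
open import Data.Product using (Σ; _×_; _,_; proj₁; proj₂)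
open import Relation.Binary using (IsEquivalence; Setoid)
open import Function.Bundles using (_⇔_; mk⇔; Equivalence)
import Relation.Binary.Reasoning.Setoid as SetoidReasoning
open import Defs

module PullbackLemmas {o ℓ e} (𝐂 : Category o ℓ e) where
  open Notions 𝐂

  ≈-refl : ∀ {A B} {f : A ⇒ B} → f ≈ f
  ≈-refl = IsEquivalence.refl equiv
  ≈-sym : ∀ {A B} {f g : A ⇒ B} → f ≈ g → g ≈ f
  ≈-sym = IsEquivalence.sym equiv
  ≈-trans : ∀ {A B} {f g h : A ⇒ B} → f ≈ g → g ≈ h → f ≈ h
  ≈-trans = IsEquivalence.trans equiv

  hom : Obj → Obj → Setoid ℓ e
  hom A B = record { Carrier = A ⇒ B ; _≈_ = _≈_ ; isEquivalence = equiv }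

  module HomReasoning {A B : Obj} = SetoidReasoning (hom A B)
  open HomReasoning

  infixr 4 _⟩∘⟨_
  _⟩∘⟨_ : ∀ {A B C} {f h : B ⇒ C} {g i : A ⇒ B} → f ≈ h → g ≈ i → f ∘ g ≈ h ∘ i
  _⟩∘⟨_ = ∘-resp-≈

  assoc⁻¹ : ∀ {A B C D} {f : A ⇒ B} {g : B ⇒ C} {h : C ⇒ D} → h ∘ (g ∘ f) ≈ (h ∘ g) ∘ f
  assoc⁻¹ = ≈-sym assoc

  extend : ∀ {A B C D X} {a : B ⇒ D} {b : A ⇒ B} {c : C ⇒ D} {d : A ⇒ C} (f : X ⇒ A) →
           a ∘ b ≈ c ∘ d → a ∘ (b ∘ f) ≈ c ∘ (d ∘ f)
  extend f sq = ≈-trans assoc⁻¹ (≈-trans (sq ⟩∘⟨ ≈-refl) assoc)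

  pullʳ : ∀ {A B C X} {a : B ⇒ C} {b : A ⇒ B} {f : X ⇒ A} {g : X ⇒ B} →
          b ∘ f ≈ g → (a ∘ b) ∘ f ≈ a ∘ g
  pullʳ eq = ≈-trans assoc (≈-refl ⟩∘⟨ eq)

  pb-swap : ∀ {P A B Z} {p₁ : P ⇒ A} {p₂ : P ⇒ B} {f : A ⇒ Z} {g : B ⇒ Z} →
            IsPullback p₁ p₂ f g → IsPullback p₂ p₁ g f
  pb-swap (sq , up) = ≈-sym sq , λ q₁ q₂ eq →
    let (u , e₁ , e₂ , uniq) = up q₂ q₁ (≈-sym eq)
    in u , e₂ , e₁ , λ v h₁ h₂ → uniq v h₂ h₁

  po-swap : ∀ {Z A B P} {f : Z ⇒ A} {g : Z ⇒ B} {i₁ : A ⇒ P} {i₂ : B ⇒ P} →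
            IsPushout f g i₁ i₂ → IsPushout g f i₂ i₁
  po-swap (sq , up) = ≈-sym sq , λ j₁ j₂ eq →
    let (u , e₁ , e₂ , uniq) = up j₂ j₁ (≈-sym eq)
    in u , e₂ , e₁ , λ v h₁ h₂ → uniq v h₂ h₁

  pb-jointly-mono : ∀ {P A B Z X} {p₁ : P ⇒ A} {p₂ : P ⇒ B} {f : A ⇒ Z} {g : B ⇒ Z} →
                    IsPullback p₁ p₂ f g → (v w : X ⇒ P) →
                    p₁ ∘ v ≈ p₁ ∘ w → p₂ ∘ v ≈ p₂ ∘ w → v ≈ w
  pb-jointly-mono (sq , up) v w e₁ e₂ =
    let (_ , _ , _ , uniq) = up _ _ (extend w sq)
    in ≈-trans (uniq v e₁ e₂) (≈-sym (uniq w ≈-refl ≈-refl))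

  pb-resp : ∀ {P A B Z} {p₁ : P ⇒ A} {p₂ : P ⇒ B} {f f' : A ⇒ Z} {g g' : B ⇒ Z} →
            IsPullback p₁ p₂ f g → f ≈ f' → g ≈ g' → IsPullback p₁ p₂ f' g'
  pb-resp (sq , up) ff gg = ≈-trans (≈-sym ff ⟩∘⟨ ≈-refl) (≈-trans sq (gg ⟩∘⟨ ≈-refl)) ,
    λ q₁ q₂ eq → up q₁ q₂ (≈-trans (ff ⟩∘⟨ ≈-refl) (≈-trans eq (≈-sym gg ⟩∘⟨ ≈-refl)))

  pb-paste : ∀ {P Q A B C Z} {p₁ : P ⇒ A} {p₂ : P ⇒ B} {f : A ⇒ Z} {g : B ⇒ Z}
               {q₁ : Q ⇒ P} {q₂ : Q ⇒ C} {h : C ⇒ B} →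
             IsPullback p₁ p₂ f g → IsPullback q₁ q₂ p₂ h →
             IsPullback (p₁ ∘ q₁) q₂ f (g ∘ h)
  pb-paste {Q = Q} {A} {C = C} {p₁ = p₁} {p₂} {f} {g} {q₁} {q₂} {h} (sq₁ , up₁) (sq₂ , up₂) = outer , universal
    where
    outer : f ∘ (p₁ ∘ q₁) ≈ (g ∘ h) ∘ q₂
    outer = begin
      f ∘ (p₁ ∘ q₁) ≈⟨ extend q₁ sq₁ ⟩
      g ∘ (p₂ ∘ q₁) ≈⟨ ≈-refl ⟩∘⟨ sq₂ ⟩
      g ∘ (h ∘ q₂)  ≈⟨ assoc⁻¹ ⟩
      (g ∘ h) ∘ q₂  ∎
    universal : ∀ {X} (a : X ⇒ A) (c : X ⇒ C) → f ∘ a ≈ (g ∘ h) ∘ c →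
                Σ (X ⇒ Q) λ u → ((p₁ ∘ q₁) ∘ u ≈ a) × (q₂ ∘ u ≈ c) ×
                  (∀ v → (p₁ ∘ q₁) ∘ v ≈ a → q₂ ∘ v ≈ c → v ≈ u)
    universal a c eq =
      let (w , p₁w , p₂w , uniq₁) = up₁ a (h ∘ c) (≈-trans eq assoc)
          (u , q₁u , q₂u , uniq₂) = up₂ w c p₂w
          uniq : ∀ v → (p₁ ∘ q₁) ∘ v ≈ a → q₂ ∘ v ≈ c → v ≈ u
          uniq v e₁ e₂ = uniq₂ v
            (uniq₁ (q₁ ∘ v) (≈-trans assoc⁻¹ e₁)
                            (≈-trans (extend v sq₂) (≈-refl ⟩∘⟨ e₂)))
            e₂
      in u , ≈-trans (pullʳ q₁u) p₁w , q₂u , uniq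

  pb-unpaste : ∀ {P Q A B C Z} {p₁ : P ⇒ A} {p₂ : P ⇒ B} {f : A ⇒ Z} {g : B ⇒ Z}
                 {r₁ : Q ⇒ A} {q₂ : Q ⇒ C} {h : C ⇒ B} →
               IsPullback p₁ p₂ f g → IsPullback r₁ q₂ f (g ∘ h) →
               (q₁ : Q ⇒ P) → p₁ ∘ q₁ ≈ r₁ → p₂ ∘ q₁ ≈ h ∘ q₂ →
               IsPullback q₁ q₂ p₂ h
  pb-unpaste {P} {Q} {C = C} {p₁ = p₁} {p₂} {f} {g} {q₂ = q₂} {h} right@(sq₁ , _) (_ , upO) q₁ e₁ e₂ =
    e₂ , universal
    where
    universal : ∀ {X} (s : X ⇒ P) (c : X ⇒ C) → p₂ ∘ s ≈ h ∘ c →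
                Σ (X ⇒ Q) λ u → (q₁ ∘ u ≈ s) × (q₂ ∘ u ≈ c) ×
                  (∀ v → q₁ ∘ v ≈ s → q₂ ∘ v ≈ c → v ≈ u)
    universal s c eq =
      let outer : f ∘ (p₁ ∘ s) ≈ (g ∘ h) ∘ c
          outer = begin
            f ∘ (p₁ ∘ s) ≈⟨ extend s sq₁ ⟩
            g ∘ (p₂ ∘ s) ≈⟨ ≈-refl ⟩∘⟨ eq ⟩
            g ∘ (h ∘ c)  ≈⟨ assoc⁻¹ ⟩
            (g ∘ h) ∘ c  ∎
          (u , r₁u , q₂u , uniq) = upO (p₁ ∘ s) c outer
          q₁u : q₁ ∘ u ≈ s
          q₁u = pb-jointly-mono right (q₁ ∘ u) s
            (≈-trans assoc⁻¹ (≈-trans (e₁ ⟩∘⟨ ≈-refl) r₁u))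
            (begin
              p₂ ∘ (q₁ ∘ u) ≈⟨ extend u e₂ ⟩
              h ∘ (q₂ ∘ u)  ≈⟨ ≈-refl ⟩∘⟨ q₂u ⟩
              h ∘ c         ≈⟨ ≈-sym eq ⟩
              p₂ ∘ s        ∎)
      in u , q₁u , q₂u , λ v e₁v e₂v →
           uniq v (≈-trans (≈-sym e₁ ⟩∘⟨ ≈-refl) (≈-trans assoc (≈-refl ⟩∘⟨ e₁v))) e₂v

  pb-restrict-mono : ∀ {P A B C Z} {p₁ : P ⇒ A} {q : P ⇒ B} {f : A ⇒ Z} {g : B ⇒ Z}
                       {p₂ : P ⇒ C} {h : C ⇒ B} →
                     IsPullback p₁ q f g → q ≈ h ∘ p₂ → Mono h →
                     IsPullback p₁ p₂ f (g ∘ h)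
  pb-restrict-mono {P = P} {q = q} {p₂ = p₂} {h = h} pb@(sq , up) factor mono =
    ≈-trans sq (≈-trans (≈-refl ⟩∘⟨ factor) assoc⁻¹) , λ a c eq →
      let (u , p₁u , qu , _) = up a (h ∘ c) (≈-trans eq assoc)
          p₂u : p₂ ∘ u ≈ c
          p₂u = mono (p₂ ∘ u) c (≈-trans (≈-sym (factor-∘ u)) qu)
      in u , p₁u , p₂u , λ v e₁ e₂ → pb-jointly-mono pb v u
           (≈-trans e₁ (≈-sym p₁u))
           (begin
             q ∘ v         ≈⟨ factor-∘ v ⟩
             h ∘ (p₂ ∘ v)  ≈⟨ ≈-refl ⟩∘⟨ ≈-trans e₂ (≈-sym p₂u) ⟩
             h ∘ (p₂ ∘ u)  ≈⟨ ≈-sym (factor-∘ u) ⟩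
             q ∘ u         ∎)
    where
    factor-∘ : ∀ {X} (v : X ⇒ P) → q ∘ v ≈ h ∘ (p₂ ∘ v)
    factor-∘ v = ≈-trans (factor ⟩∘⟨ ≈-refl) assoc

  pb-postcompose-mono : ∀ {P A B Z W} {p₁ : P ⇒ A} {p₂ : P ⇒ B} {f : A ⇒ Z} {g : B ⇒ Z}
                          {m : Z ⇒ W} →
                        Mono m → IsPullback p₁ p₂ f g → IsPullback p₁ p₂ (m ∘ f) (m ∘ g)
  pb-postcompose-mono mono (sq , up) =
    ≈-trans assoc (≈-trans (≈-refl ⟩∘⟨ sq) assoc⁻¹) , λ q₁ q₂ eq →
      up q₁ q₂ (mono _ _ (≈-trans assoc⁻¹ (≈-trans eq assoc)))

  pb-identity : ∀ {A B} {f : A ⇒ B} → IsPullback id f f id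
  pb-identity = ≈-trans identityʳ (≈-sym identityˡ) , λ q₁ q₂ eq →
    q₁ , identityˡ , ≈-trans eq identityˡ , λ v e₁ _ → ≈-trans (≈-sym identityˡ) e₁

  pb-kernel-pair-mono : ∀ {A B} {f : A ⇒ B} → Mono f → IsPullback id id f f
  pb-kernel-pair-mono mono = ≈-refl , λ q₁ q₂ eq →
    q₁ , identityˡ , ≈-trans identityˡ (mono q₁ q₂ eq) , λ v e₁ _ → ≈-trans (≈-sym identityˡ) e₁

  po-identity : ∀ {A B} {f : A ⇒ B} → IsPushout f id id f
  po-identity = ≈-trans identityˡ (≈-sym identityʳ) , λ j₁ j₂ eq →
    j₁ , identityʳ , ≈-trans eq identityʳ , λ v e₁ _ → ≈-trans (≈-sym identityʳ) e₁

module AdhesiveLemmas {o ℓ e m} (𝐂 : Category o ℓ e)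
  (M : ∀ {A B} → Category._⇒_ 𝐂 A B → Set m) (MA : IsMAdhesive 𝐂 M) where
  open Notions 𝐂
  open IsMAdhesive MA
  open PullbackLemmas 𝐂

  M-id : ∀ {A} → M (id {A})
  M-id = M-iso (id , identityˡ , identityˡ)

  -- Pushouts along M are pullbacks: apply van Kampen to the cube whose top face
  -- is the trivial pushout of f along id.
  po-M⇒pb : ∀ {A B C D} {f : A ⇒ B} {m : A ⇒ C} {n : B ⇒ D} {g : C ⇒ D} →
            M m → IsPushout f m n g → IsPullback m f g n
  po-M⇒pb {f = f} {m} {n} Mm po = proj₂ (Equivalence.to (vk {f' = f} {m' = id} {n' = id} {g' = f}
      {a = id} {b = id} {c = m} {d = n}
      Mm po (≈-trans identityˡ (≈-sym identityʳ)) pb-identity (pb-kernel-pair-mono (M-mono Mm))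
      ≈-refl (≈-sym (proj₁ po)) M-id Mm (M-pushout-stable (po-swap po) Mm)) po-identity)

  -- The missing
  -- edge m' of the top face comes from the universal property of C', the face
  -- containing it is a pullback by pasting, and van Kampen concludes.
  pullback-of-M-pushout :
    ∀ {A B C D A' B' C' D'} {f : A ⇒ B} {m : A ⇒ C} {n : B ⇒ D} {g : C ⇒ D} {d : D' ⇒ D}
      {b : B' ⇒ B} {n' : B' ⇒ D'} {c : C' ⇒ C} {g' : C' ⇒ D'} {a : A' ⇒ A} {f' : A' ⇒ B'} →
    M m → IsPushout f m n g → M d →
    IsPullback b n' n d → IsPullback c g' g d → IsPullback a f' f b →
    Σ (A' ⇒ C') λ m' → IsPullback a m' m c × IsPushout f' m' n' g'
  pullback-of-M-pushout {m = m} {g = g} {d = d} {n' = n'} {c} {g'} {a} {f'}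
                        Mm po Md pbB pbC pbA =
    let
        pbOuter : IsPullback (n' ∘ f') a d (g ∘ m)
        pbOuter = pb-resp (pb-paste (pb-swap pbB) (pb-swap pbA)) ≈-refl (proj₁ po)
        (m' , cm' , g'm' , _) = proj₂ pbC (m ∘ a) (n' ∘ f') (≈-sym (≈-trans (proj₁ pbOuter) assoc))
        pbA' : IsPullback a m' m c
        pbA' = pb-swap (pb-unpaste (pb-swap pbC) pbOuter m' g'm' cm')
    in m' , pbA' , Equivalence.from
         (vk Mm po (≈-sym g'm') pbA pbA' (proj₁ pbB) (proj₁ pbC)
             (M-pullback-stable pbB Md) (M-pullback-stable pbC Md) Md)
         (pbB , pbC)

  union-embedding : MEffectiveUnions 𝐂 M →
    ∀ {A B C D E} {a : A ⇒ B} {b : A ⇒ C} {f : B ⇒ D} {g : C ⇒ D} {i₁ : B ⇒ E} {i₂ : C ⇒ E} →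
    M f → M g → IsPullback a b f g → IsPushout a b i₁ i₂ →
    Σ (E ⇒ D) λ u → M u × (u ∘ i₁ ≈ f) × (u ∘ i₂ ≈ g)
  union-embedding EU Mf Mg pb po =
    let (u , ui₁ , ui₂ , _) = proj₂ po _ _ (proj₁ pb)
    in u , EU u Mf Mg pb po ui₁ ui₂ , ui₁ , ui₂

module SqPOStep {o ℓ e m n} (𝐂 : Category o ℓ e)
  (M : ∀ {A B} → Category._⇒_ 𝐂 A B → Set m) (MA : IsMAdhesive 𝐂 M)
  (EU : MEffectiveUnions 𝐂 M) (M-FPC : MStableUnderFPC 𝐂 M)
  (𝒩 : Category.Obj 𝐂 → Set n) where
  open Constraints 𝐂 M 𝒩
  open IsMAdhesive MA
  open PullbackLemmas 𝐂
  open AdhesiveLemmas 𝐂 M MA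

  ⊨-sub : ∀ {A X} → X ⊨c𝒩 → (f : A ⇒ X) → M f → A ⊨c𝒩
  ⊨-sub X⊨ f Mf N 𝒩N (g , Mg) = X⊨ N 𝒩N (f ∘ g , M-comp Mg Mf)

  module _ {O K I X₀ X̄₀ X₁} (rO : K ⇒ O) (rI : K ⇒ I) (MrO : M rO) (MrI : M rI)
    (O⊨ : O ⊨c𝒩) (K⊨ : K ⊨c𝒩) (X₀⊨ : X₀ ⊨c𝒩) (mt : I ⇒ X₀) (Mmt : M mt)
    (k : K ⇒ X̄₀) (x̄ : X̄₀ ⇒ X₀) (fpc : IsFPC rI mt k x̄)
    (o₁ : O ⇒ X₁) (o₂ : X̄₀ ⇒ X₁) (po : IsPushout rO k o₁ o₂) where

    Mk : M k
    Mk = proj₁ (M-FPC MrI Mmt fpc)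
    Mx̄ : M x̄
    Mx̄ = proj₂ (M-FPC MrI Mmt fpc)
    Mo₁ : M o₁
    Mo₁ = M-pushout-stable (po-swap po) Mk
    Mo₂ : M o₂
    Mo₂ = M-pushout-stable po MrO
    fpc-pb : IsPullback rI k mt x̄
    fpc-pb = proj₁ fpc

    record Anchored : Set (o ⊔ ℓ ⊔ e ⊔ m ⊔ n) where
      field
        {C₁ D C₂} : Obj
        δ₂ : D ⇒ C₂
        δ₁ : D ⇒ C₁
        forbidden : InS𝒩 δ₂ δ₁
        x : C₂ ⇒ O
        y : D ⇒ K
        Mx : M x
        My : M y
        embedding : IsPullback δ₂ y x rO
        h : C₁ ⇒ X̄₀
        Mh : M h
        over-X̄₀ : IsPullback y δ₁ k h

    -- A violation N ↪ X₁ yields an anchored overlap: pull N back to C₂ over O and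
    -- C₁ over X̄₀, and C₂ back to D over K; then D is a pullback over X̄₀ and N is
    -- the pushout of C₂ ↩ D ↪ C₁, so this span lies in S_𝒩.
    violation⇒anchored : ∀ {N} → 𝒩 N → Σ (N ⇒ X₁) M → Anchored
    violation⇒anchored {N} 𝒩N (ν , Mν) =
      let (_ , x , q , pbC₂) = pullback-M o₁ ν Mν
          (_ , h , c , pbC₁) = pullback-M o₂ ν Mν
          Mx = M-pullback-stable pbC₂ Mν
          (_ , y , δ₂ , pbD) = pullback-M rO x Mx
          My = M-pullback-stable pbD Mx
          Mh = M-pullback-stable pbC₁ Mν
          (δ₁ , over-X̄₀ , N-pushout) = pullback-of-M-pushout Mk po Mν pbC₂ pbC₁ pbD
          forbidden : InS𝒩 δ₂ δ₁
          forbidden = M-pullback-stable (pb-swap pbD) MrO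
                    , M-pullback-stable (pb-swap over-X̄₀) Mk
                    , ⊨-sub O⊨ x Mx , ⊨-sub K⊨ y My , ⊨-sub X₀⊨ (x̄ ∘ h) (M-comp Mh Mx̄)
                    , (N , q , c , N-pushout , (N , 𝒩N , (id , (id , identityˡ , identityˡ))))
      in record
        { δ₂ = δ₂ ; δ₁ = δ₁ ; forbidden = forbidden
        ; x = x ; y = y ; Mx = Mx ; My = My ; embedding = pb-swap pbD
        ; h = h ; Mh = Mh ; over-X̄₀ = over-X̄₀ }

    -- An anchored overlap yields a violation N ↪ X₁: the square of C₂ and C₁ over
    -- X₁ is a pullback of M-morphisms, so by M-effective unions its pushout,
    -- which is isomorphic to some N ∈ 𝒩, embeds into X₁.
    anchored⇒violation : Anchored → Σ Obj λ N → 𝒩 N × Σ (N ⇒ X₁) M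
    anchored⇒violation A =
      let open Anchored A
          (_ , _ , _ , _ , _ , (_ , _ , _ , span-pushout , (N , 𝒩N , (φ , (φ⁻¹ , φ⁻¹φ , φφ⁻¹))))) = forbidden
          -- K is the pullback of O and X̄₀ over X₁, since X₁ is a pushout along M
          pbK : IsPullback k rO o₂ o₁
          pbK = po-M⇒pb Mk po
          pbD : IsPullback δ₂ δ₁ (o₁ ∘ x) (o₂ ∘ h)
          pbD = pb-restrict-mono (pb-swap (pb-paste pbK (pb-swap embedding)))
                  (proj₁ over-X̄₀) (M-mono Mh)
          (v , Mv , _ , _) = union-embedding EU (M-comp Mx Mo₁) (M-comp Mh Mo₂) pbD span-pushout
      in N , 𝒩N , (v ∘ φ⁻¹ , M-comp (M-iso (φ , φφ⁻¹ , φ⁻¹φ)) Mv)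

    -- An anchored overlap yields a match P ↪ X₀ of the pushout P of C₁ ↩ D ↪ I
    -- compatible with mt: D is the pullback of C₁ and I over X₀ (pasting with the
    -- FPC square), so M-effective unions embed P into X₀.
    anchored⇒match : (A : Anchored) → let open Anchored A in
      ∀ {P} (p₁ : C₁ ⇒ P) (p₂ : I ⇒ P) → IsPushout δ₁ (rI ∘ y) p₁ p₂ →
      Σ (P ⇒ X₀) λ g → M g × (g ∘ p₂ ≈ mt)
    anchored⇒match A p₁ p₂ P-pushout =
      let open Anchored A
          pbD : IsPullback δ₁ (rI ∘ y) (x̄ ∘ h) mt
          pbD = pb-swap (pb-paste fpc-pb over-X̄₀)
          (g , Mg , _ , gp₂) = union-embedding EU (M-comp Mh Mx̄) Mmt pbD P-pushout
      in g , Mg , gp₂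

    -- A match P ↪ X₀ compatible with mt yields an anchored overlap: D is the
    -- pullback of I and C₁ over X₀, so the FPC property provides h : C₁ → X̄₀.
    match⇒anchored : ∀ {C₁ D C₂} (δ₂ : D ⇒ C₂) (δ₁ : D ⇒ C₁) → InS𝒩 δ₂ δ₁ →
      ∀ (x : C₂ ⇒ O) (y : D ⇒ K) → M x → M y → IsPullback δ₂ y x rO →
      ∀ {P} (p₁ : C₁ ⇒ P) (p₂ : I ⇒ P) → IsPushout δ₁ (rI ∘ y) p₁ p₂ →
      Σ (P ⇒ X₀) (λ g → M g × (g ∘ p₂ ≈ mt)) → Anchored
    match⇒anchored δ₂ δ₁ forbidden x y Mx My embedding p₁ p₂ P-pushout (g , Mg , gp₂) =
      let Mry = M-comp My MrI
          -- the pushout P along the M-morphism rI ∘ y is a pullback, and stays one in X₀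
          pbX₀ : IsPullback (rI ∘ y) δ₁ mt (g ∘ p₁)
          pbX₀ = pb-resp (pb-postcompose-mono (M-mono Mg) (po-M⇒pb Mry P-pushout)) gp₂ ≈-refl
          (h , x̄h , hδ₁ , _) = proj₂ fpc (rI ∘ y) δ₁ (g ∘ p₁) y pbX₀ ≈-refl
          Mp₁ = M-pushout-stable (po-swap P-pushout) Mry
          Mh : M h
          Mh = M-decomp (M-resp-≈ (≈-sym x̄h) (M-comp Mp₁ Mg)) Mx̄
          over-X̄₀ : IsPullback y δ₁ k h
          over-X̄₀ = pb-unpaste fpc-pb (pb-resp pbX₀ ≈-refl (≈-sym x̄h)) y ≈-refl (≈-sym hδ₁)
      in record
        { δ₂ = δ₂ ; δ₁ = δ₁ ; forbidden = forbidden
        ; x = x ; y = y ; Mx = Mx ; My = My ; embedding = embedding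
        ; h = h ; Mh = Mh ; over-X̄₀ = over-X̄₀ }

    -- If the match satisfies c_I then X₁ ⊨ c_𝒩: a violation would give an anchored
    -- overlap, hence a pushout P ⊨ c_𝒩 matched compatibly with mt.
    cI⇒X₁⊨ : mt ⊨cI[ rO , rI ] → X₁ ⊨c𝒩
    cI⇒X₁⊨ cI N 𝒩N violation =
      let A = violation⇒anchored 𝒩N violation
          open Anchored A
          Mδ₁ : M δ₁
          Mδ₁ = proj₁ (proj₂ forbidden)
          (_ , p₁ , p₂ , P-pushout) = pushout-M δ₁ (rI ∘ y) Mδ₁
          (g , Mg , gp₂) = anchored⇒match A p₁ p₂ P-pushout
      in cI δ₂ δ₁ forbidden x y Mx My embedding p₁ p₂ P-pushout (⊨-sub X₀⊨ g Mg) (g , Mg , gp₂)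

    -- If X₁ ⊨ c_𝒩 then the match satisfies c_I: a match of some P would give an
    -- anchored overlap, hence a violation in X₁.
    X₁⊨⇒cI : X₁ ⊨c𝒩 → mt ⊨cI[ rO , rI ]
    X₁⊨⇒cI X₁⊨ δ₂ δ₁ forbidden x y Mx My embedding p₁ p₂ P-pushout _ match =
      let (N , 𝒩N , violation) =
            anchored⇒violation (match⇒anchored δ₂ δ₁ forbidden x y Mx My embedding p₁ p₂ P-pushout match)
      in X₁⊨ N 𝒩N violation

corollary1 : ∀ {o ℓ e m n} (𝐂 : Category o ℓ e)
    (M : ∀ {A B} → Category._⇒_ 𝐂 A B → Set m) →
    IsMAdhesive 𝐂 M → Finitary 𝐂 M → MEffectiveUnions 𝐂 M →
    HasMInitial 𝐂 M → HasEpiMFactorisation 𝐂 M →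
    HasFPCsForM 𝐂 M → MStableUnderFPC 𝐂 M →
    (𝒩 : Category.Obj 𝐂 → Set n) →
    let open Constraints 𝐂 M 𝒩 in
    ∀ {O K I} (rO : K ⇒ O) (rI : K ⇒ I) → M rO → M rI →
    O ⊨c𝒩 → K ⊨c𝒩 → I ⊨c𝒩 →
    ∀ {X₀} → X₀ ⊨c𝒩 → (mt : I ⇒ X₀) → M mt →
    ∀ {X̄₀} (k : K ⇒ X̄₀) (x : X̄₀ ⇒ X₀) → IsFPC rI mt k x →
    ∀ {X₁} (o₁ : O ⇒ X₁) (o₂ : X̄₀ ⇒ X₁) → IsPushout rO k o₁ o₂ →
    (X₁ ⊨c𝒩 ⇔ mt ⊨cI[ rO , rI ])
corollary1 𝐂 M MA _ EU _ _ _ M-FPC 𝒩 rO rI MrO MrI O⊨ K⊨ _ X₀⊨ mt Mmt k x fpc o₁ o₂ po =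
  mk⇔ (X₁⊨⇒cI rO rI MrO MrI O⊨ K⊨ X₀⊨ mt Mmt k x fpc o₁ o₂ po)
      (cI⇒X₁⊨ rO rI MrO MrI O⊨ K⊨ X₀⊨ mt Mmt k x fpc o₁ o₂ po)
  where open SqPOStep 𝐂 M MA EU M-FPC 𝒩
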